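{- In the setting of the context, for each team $t$ with home venue $v$, let $\ell_{\mathrm A}(t)$ be the traveling distance of $t$ in $K^*_{\mathrm{DRR}}$ under Assumption A. Then the average, over $m\in\{0,1,\dots,2n-3\}$, of the (ordinary, i.e. starting and ending at home) traveling distance of team $t$ in $K^*_{\mathrm{DRR}}(m)$ is at most $\ell_{\mathrm A}(t) + \frac{1}{n-1}\sum_{v'\in V\setminus\{v\}} d_{vv'}$.
   Context: $n\ge4$ even teams $\{0,\dots,n-1\}$; $d_{ij}\ge0$ is the distance between home venues of teams $i,j$, with $d_{ii}=0$, symmetry, triangle inequality; $V$ is the set of home venues. A game "$i$ at $j$" is played at $j$'s venue. The ordinary traveling distance of a team: it starts at its home venue, travels in slot order to the venues of its games, and returns home after the last slot. Assumption A: the traveling distance of a team is $\sum_{s=0}^{2n-3} d(w_s,w_{s+1})$ where $w_s$ is the venue of its game in slot $s$ and $w_{2n-2}=w_0$. Construction: $v^*$ attains $\min_{v\in V}\sum_{v'\in V\setminus\{v\}}d_{vv'}$, its team named $n-1$; $(v_0,\dots,v_{n-2})$ is the Hamilton cycle on $V\setminus\{v^*\}$ produced by Christofides' 1.5-approximation algorithm, the team with venue $v_i$ named $i$. For $t\in\{0,\dots,n-1\}$, $s\in\{0,\dots,n-2\}$: $K^*(t,s)=s-t\pmod{n-1}$ if $t\ne n-1$ and $s-t\not\equiv t\pmod{n-1}$; $K^*(t,s)=n-1$ if $t\ne n-1$ and $s-t\equiv t\pmod{n-1}$; $K^*(n-1,s)=s/2$ for $s$ even, $(s+n-1)/2$ for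 $s$ odd. $K^*_{\mathrm{DRR}}$ (slots $0,\dots,2n-3$): in slots $s$ and $s+n-1$ team $t$ plays $K^*(t,s)$; for $t\in\{0,\dots,n/2-1\}$ games in slots $2t,\dots,n+2t-2$ are home, others away; for $t\in\{n/2,\dots,n-2\}$ games in slots $2t-n+2,\dots,2t$ are away, others home; team $n-1$ is away in slots $0,\dots,n-2$, home otherwise. $K^*_{\mathrm{DRR}}(m)$ ($0\le m\le 2n-3$) has in slot $s$ the games of $K^*_{\mathrm{DRR}}$ in slot $s+m\pmod{2n-2}$.
   Formalization: The distances $d_{ij}$ between home venues take values in the rationals. -}

module Defs where

open import Data.Bool using (Bool; true; false; if_then_else_; not; _∧_)
open import Data.Nat as ℕ using (ℕ; zero; suc; _∸_; _≡ᵇ_; _<ᵇ_; _≤ᵇ_; ⌊_/2⌋; _%_)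
open import Relation.Binary.PropositionalEquality using (_≡_)
open import Data.Rational using (ℚ; 0ℚ; _+_; _≤_)

-- Teams and home venues are identified with their names 0..n-1 as fixed by
-- the construction (team n-1 has venue v*, team i < n-1 has venue v_i).
-- Distances are given as d : ℕ → ℕ → ℚ; only values on indices < n matter.

record IsDist (n : ℕ) (d : ℕ → ℕ → ℚ) : Set where
  field
    nonneg : ∀ i j → i ℕ.< n → j ℕ.< n → 0ℚ ≤ d i j
    diag   : ∀ i → i ℕ.< n → d i i ≡ 0ℚ
    symm   : ∀ i j → i ℕ.< n → j ℕ.< n → d i j ≡ d j i
    tri    : ∀ i j k → i ℕ.< n → j ℕ.< n → k ℕ.< n → d i k ≤ d i j + d j k

sumTo : ℕ → (ℕ → ℚ) → ℚ
sumTo zero    f = 0ℚ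
sumTo (suc k) f = sumTo k f + f k

distSum : (ℕ → ℕ → ℚ) → ℕ → ℕ → ℚ
distSum d n v = sumTo n (λ v' → if v' ≡ᵇ v then 0ℚ else d v v')

-- (s - t) mod k, for s, t < k
subMod : ℕ → ℕ → ℕ → ℕ
subMod k s t = if t ≤ᵇ s then s ∸ t else (s ℕ.+ k) ∸ t

-- K*(t, s), t ∈ {0..n-1}, s ∈ {0..n-2}
Kstar : ℕ → ℕ → ℕ → ℕ
Kstar n t s =
  if t ≡ᵇ (n ∸ 1)
  then (if (s % 2) ≡ᵇ 0 then ⌊ s /2⌋ else ⌊ (s ℕ.+ (n ∸ 1)) /2⌋)
  else (if subMod (n ∸ 1) s t ≡ᵇ t then n ∸ 1 else subMod (n ∸ 1) s t)

-- K*_DRR: opponent of team t in slot s ∈ {0..2n-3}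
-- (slots s and s+n-1 both use K*(t,s))
oppDRR : ℕ → ℕ → ℕ → ℕ
oppDRR n t s = Kstar n t (if s <ᵇ (n ∸ 1) then s else s ∸ (n ∸ 1))

homeDRR : ℕ → ℕ → ℕ → Bool
homeDRR n t s =
  if t ≡ᵇ (n ∸ 1)
  then not (s ≤ᵇ (n ∸ 2))
  else (if t <ᵇ ⌊ n /2⌋
        then ((2 ℕ.* t) ≤ᵇ s) ∧ (s ≤ᵇ ((n ℕ.+ 2 ℕ.* t) ∸ 2))
        else not ((((2 ℕ.* t ℕ.+ 2) ∸ n) ≤ᵇ s) ∧ (s ≤ᵇ (2 ℕ.* t))))

venueDRR : ℕ → ℕ → ℕ → ℕ
venueDRR n t s = if homeDRR n t s then t else oppDRR n t s

-- slot s of K*_DRR(m) is slot (s + m) mod (2n-2) of K*_DRR (s, m ≤ 2n-3)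
rotSlot : ℕ → ℕ → ℕ → ℕ
rotSlot n m s =
  if (s ℕ.+ m) <ᵇ (2 ℕ.* n ∸ 2) then s ℕ.+ m else (s ℕ.+ m) ∸ (2 ℕ.* n ∸ 2)

venueRot : ℕ → ℕ → ℕ → ℕ → ℕ
venueRot n m t s = venueDRR n t (rotSlot n m s)

-- ℓ_A(t): traveling distance of t in K*_DRR under Assumption A
-- Σ_{s=0}^{2n-3} d(w_s, w_{s+1}) with w_{2n-2} = w_0
travelA : (ℕ → ℕ → ℚ) → ℕ → ℕ → ℚ
travelA d n t =
  sumTo (2 ℕ.* n ∸ 2)
    (λ s → d (venueDRR n t s)
             (venueDRR n t (if suc s ≡ᵇ (2 ℕ.* n ∸ 2) then 0 else suc s)))

travelOrd : (ℕ → ℕ → ℚ) → ℕ → ℕ → ℕ → ℚ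
travelOrd d n m t =
  d t (venueRot n m t 0)
  + sumTo (2 ℕ.* n ∸ 3) (λ s → d (venueRot n m t s) (venueRot n m t (suc s)))
  + d (venueRot n m t (2 ℕ.* n ∸ 3)) t

module Submission where

-- Let w s be the venue of t in slot s of K*_DRR.  Started at slot m,
-- the ordinary tour is the closed cyclic walk ℓ_A(t) through w, cut open at
-- w m and joined to home at both ends; by the triangle inequality it costs at
-- most ℓ_A(t) + 2·d(t, w m).  Averaging over the L = 2n-2 rotations gives
-- ℓ_A(t) + (2/L) Σ_m d(t, w m), and 2/L = 1/(n-1).  Finally, slots s and
-- s+(n-1) have the same opponent K*(t,s) and t is at home in at least one of
-- them, while K*(t,·) meets every team at most once, so
-- Σ_m d(t, w m) ≤ Σ_{v'≠t} d t v'.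

open import Defs
open import Data.Nat using (ℕ; _∸_; _%_; _<_; _≤_; suc) renaming (_*_ to _*ℕ_)
open import Data.Integer using (+_)
open import Data.Rational using (ℚ; _/_; _*_; _+_) renaming (_≤_ to _≤ℚ_)
open import Relation.Binary.PropositionalEquality using (_≡_)

open import Data.Nat
  using (zero; z≤n; s≤s; z<s; NonZero; >-nonZero; _≡ᵇ_; _<ᵇ_; _≤ᵇ_; ⌊_/2⌋; _<?_; _≤?_)
  renaming (_+_ to _+ℕ_)
open import Data.Nat.Properties
open import Data.Nat.DivMod using (m<n⇒m%n≡m; [m+n]%n≡m%n)
open import Data.Nat.Solver using () renaming (module +-*-Solver to ℕSolver)
import Data.Integer.Properties as ℤP
open import Data.Integer.Solver using () renaming (module +-*-Solver to ℤSolver)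
open import Data.Rational using (0ℚ; 1ℚ; toℚᵘ)
import Data.Rational.Properties as ℚP
open import Data.Rational.Solver using (module +-*-Solver)
import Data.Rational.Unnormalised as ℚᵘ
import Data.Rational.Unnormalised.Properties as ℚᵘP
open import Data.Bool using (Bool; true; false; if_then_else_; not; _∧_)
open import Data.Bool.Properties using (∧-zeroʳ)
open import Data.Empty using (⊥-elim)
open import Data.Product using (∃-syntax; _,_)
open import Data.Sum using (_⊎_; inj₁; inj₂)
open import Relation.Nullary using (¬_; yes; no)
open import Relation.Nullary.Reflects using (Reflects; ofʸ; ofⁿ; fromEquivalence)
open import Relation.Binary.Definitions using (tri<; tri≈; tri>)
open import Relation.Binary.PropositionalEquality
  using (refl; sym; trans; cong; cong₂; subst; _≢_; module ≡-Reasoning)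

reflects-true : ∀ {P : Set} {b} → Reflects P b → P → b ≡ true
reflects-true (ofʸ _)  _ = refl
reflects-true (ofⁿ ¬p) p = ⊥-elim (¬p p)

reflects-false : ∀ {P : Set} {b} → Reflects P b → ¬ P → b ≡ false
reflects-false (ofʸ p) ¬p = ⊥-elim (¬p p)
reflects-false (ofⁿ _) _  = refl

≡ᵇ-reflects-≡ : ∀ m n → Reflects (m ≡ n) (m ≡ᵇ n)
≡ᵇ-reflects-≡ m n = fromEquivalence (≡ᵇ⇒≡ m n) (≡⇒≡ᵇ m n)

sum-cong : ∀ k {f g : ℕ → ℚ} → (∀ i → i < k → f i ≡ g i) → sumTo k f ≡ sumTo k g
sum-cong zero    _   = refl
sum-cong (suc k) f≡g =
  cong₂ _+_ (sum-cong k (λ i i<k → f≡g i (m<n⇒m<1+n i<k))) (f≡g k (n<1+n k))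

sum-mono : ∀ k {f g : ℕ → ℚ} → (∀ i → i < k → f i ≤ℚ g i) → sumTo k f ≤ℚ sumTo k g
sum-mono zero    _   = ℚP.≤-refl
sum-mono (suc k) f≤g =
  ℚP.+-mono-≤ (sum-mono k (λ i i<k → f≤g i (m<n⇒m<1+n i<k))) (f≤g k (n<1+n k))

sum-nonneg : ∀ k {f : ℕ → ℚ} → (∀ i → i < k → 0ℚ ≤ℚ f i) → 0ℚ ≤ℚ sumTo k f
sum-nonneg zero    _   = ℚP.≤-refl
sum-nonneg (suc k) f≥0 =
  ℚP.+-mono-≤ (sum-nonneg k (λ i i<k → f≥0 i (m<n⇒m<1+n i<k))) (f≥0 k (n<1+n k))

sum-+ : ∀ k (f g : ℕ → ℚ) → sumTo k (λ i → f i + g i) ≡ sumTo k f + sumTo k g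
sum-+ zero    f g = refl
sum-+ (suc k) f g = begin
    sumTo k (λ i → f i + g i) + (f k + g k)
  ≡⟨ cong (_+ (f k + g k)) (sum-+ k f g) ⟩
    (sumTo k f + sumTo k g) + (f k + g k)
  ≡⟨ solve 4 (λ a b c d → (a :+ b) :+ (c :+ d) := (a :+ c) :+ (b :+ d))
             refl (sumTo k f) (sumTo k g) (f k) (g k) ⟩
    (sumTo k f + f k) + (sumTo k g + g k) ∎
  where open ≡-Reasoning
        open +-*-Solver

sum-split : ∀ a b (f : ℕ → ℚ) → sumTo (a +ℕ b) f ≡ sumTo a f + sumTo b (λ i → f (a +ℕ i))
sum-split a zero    f = begin
    sumTo (a +ℕ 0) f        ≡⟨ cong (λ x → sumTo x f) (+-identityʳ a) ⟩
    sumTo a f               ≡⟨ sym (ℚP.+-identityʳ _) ⟩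
    sumTo a f + 0ℚ          ∎
  where open ≡-Reasoning
sum-split a (suc b) f = begin
    sumTo (a +ℕ suc b) f
  ≡⟨ cong (λ x → sumTo x f) (+-suc a b) ⟩
    sumTo (a +ℕ b) f + f (a +ℕ b)
  ≡⟨ cong (_+ f (a +ℕ b)) (sum-split a b f) ⟩
    (sumTo a f + sumTo b (λ i → f (a +ℕ i))) + f (a +ℕ b)
  ≡⟨ ℚP.+-assoc (sumTo a f) _ _ ⟩
    sumTo a f + sumTo (suc b) (λ i → f (a +ℕ i)) ∎
  where open ≡-Reasoning

sum-const : ∀ k (c : ℚ) → sumTo k (λ _ → c) ≡ sumTo k (λ _ → 1ℚ) * c
sum-const zero    c = sym (ℚP.*-zeroˡ c)
sum-const (suc k) c = begin
    sumTo k (λ _ → c) + c               ≡⟨ cong (_+ c) (sum-const k c) ⟩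
    sumTo k (λ _ → 1ℚ) * c + c          ≡⟨ solve 2 (λ s c → s :* c :+ c := (s :+ con 1ℚ) :* c)
                                                  refl (sumTo k (λ _ → 1ℚ)) c ⟩
    (sumTo k (λ _ → 1ℚ) + 1ℚ) * c       ∎
  where open ≡-Reasoning
        open +-*-Solver

punctured : ℕ → (ℕ → ℚ) → ℕ → ℚ
punctured x g v = if v ≡ᵇ x then 0ℚ else g v

punctured-self : ∀ x (g : ℕ → ℚ) → punctured x g x ≡ 0ℚ
punctured-self x g rewrite reflects-true (≡ᵇ-reflects-≡ x x) refl = refl

punctured-other : ∀ {x v} (g : ℕ → ℚ) → v ≢ x → punctured x g v ≡ g v
punctured-other {x} {v} g v≢x rewrite reflects-false (≡ᵇ-reflects-≡ v x) v≢x = refl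

punctured-nonneg : ∀ {N} x {g : ℕ → ℚ} → (∀ v → v < N → 0ℚ ≤ℚ g v) →
                   ∀ v → v < N → 0ℚ ≤ℚ punctured x g v
punctured-nonneg x g≥0 v v<N with v ≡ᵇ x
... | true  = ℚP.≤-refl
... | false = g≥0 v v<N

sum-punctured : ∀ N x (g : ℕ → ℚ) → x < N → sumTo N g ≡ sumTo N (punctured x g) + g x
sum-punctured (suc N) x g x<1+N with m≤n⇒m<n∨m≡n (≤-pred x<1+N)
... | inj₁ x<N = begin
    sumTo N g + g N
  ≡⟨ cong (_+ g N) (sum-punctured N x g x<N) ⟩
    (sumTo N (punctured x g) + g x) + g N
  ≡⟨ solve 3 (λ a b c → (a :+ b) :+ c := (a :+ c) :+ b) refl (sumTo N (punctured x g)) (g x) (g N) ⟩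
    (sumTo N (punctured x g) + g N) + g x
  ≡⟨ cong (λ y → (sumTo N (punctured x g) + y) + g x)
          (sym (punctured-other g (λ N≡x → <-irrefl (sym N≡x) x<N))) ⟩
    (sumTo N (punctured x g) + punctured x g N) + g x ∎
  where open ≡-Reasoning
        open +-*-Solver
... | inj₂ refl = begin
    sumTo x g + g x
  ≡⟨ cong (_+ g x) (sum-cong x (λ v v<x → sym (punctured-other g (<⇒≢ v<x)))) ⟩
    sumTo x (punctured x g) + g x
  ≡⟨ cong (_+ g x) (sym (ℚP.+-identityʳ (sumTo x (punctured x g)))) ⟩
    (sumTo x (punctured x g) + 0ℚ) + g x
  ≡⟨ cong (λ y → (sumTo x (punctured x g) + y) + g x) (sym (punctured-self x g)) ⟩
    (sumTo x (punctured x g) + punctured x g x) + g x ∎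
  where open ≡-Reasoning

sum-reindex-≤ : ∀ k N (f : ℕ → ℕ) (g : ℕ → ℚ) →
                (∀ s → s < k → f s < N) →
                (∀ i j → i < k → j < k → f i ≡ f j → i ≡ j) →
                (∀ v → v < N → 0ℚ ≤ℚ g v) →
                sumTo k (λ s → g (f s)) ≤ℚ sumTo N g
sum-reindex-≤ zero    N f g _   _     g≥0 = sum-nonneg N g≥0
sum-reindex-≤ (suc k) N f g f<N f-inj g≥0 = begin
    sumTo k (λ s → g (f s)) + g (f k)
  ≡⟨ cong (_+ g (f k)) (sum-cong k λ s s<k → sym (punctured-other g (f-distinct s s<k))) ⟩
    sumTo k (λ s → punctured (f k) g (f s)) + g (f k)
  ≤⟨ ℚP.+-monoˡ-≤ (g (f k))
       (sum-reindex-≤ k N f (punctured (f k) g)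
          (λ s s<k → f<N s (m<n⇒m<1+n s<k))
          (λ i j i<k j<k → f-inj i j (m<n⇒m<1+n i<k) (m<n⇒m<1+n j<k))
          (punctured-nonneg (f k) g≥0)) ⟩
    sumTo N (punctured (f k) g) + g (f k)
  ≡⟨ sym (sum-punctured N (f k) g (f<N k (n<1+n k))) ⟩
    sumTo N g ∎
  where
    open ℚP.≤-Reasoning
    f-distinct : ∀ s → s < k → f s ≢ f k
    f-distinct s s<k e = <-irrefl (f-inj s k (m<n⇒m<1+n s<k) (n<1+n k) e) s<k

ones-sum : ∀ j → toℚᵘ (sumTo j (λ _ → 1ℚ)) ℚᵘ.≃ ℚᵘ.mkℚᵘ (+ j) 0
ones-sum zero    = ℚᵘ.*≡* refl
ones-sum (suc j) =
  ℚᵘP.≃-trans (ℚP.toℚᵘ-homo-+ (sumTo j (λ _ → 1ℚ)) 1ℚ)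
  (ℚᵘP.≃-trans (ℚᵘP.+-cong (ones-sum j) (ℚᵘP.≃-refl {ℚᵘ.mkℚᵘ (+ 1) 0}))
  (ℚᵘ.*≡* (solve 1 (λ x → (x :* con (+ 1) :+ con (+ 1) :* con (+ 1)) :* con (+ 1)
                          := (con (+ 1) :+ x) :* con (+ 1)) refl (+ j))))
  where open ℤSolver

unit-fraction : ∀ k → toℚᵘ (+ 1 / suc k) ℚᵘ.≃ ℚᵘ.mkℚᵘ (+ 1) k
unit-fraction k = ℚP.toℚᵘ-fromℚᵘ (ℚᵘ.mkℚᵘ (+ 1) k)

mean-weight : ∀ k → (+ 1 / suc k) * sumTo (suc k) (λ _ → 1ℚ) ≡ 1ℚ
mean-weight k = ℚP.toℚᵘ-injective
  (ℚᵘP.≃-trans (ℚP.toℚᵘ-homo-* (+ 1 / suc k) (sumTo (suc k) (λ _ → 1ℚ)))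
  (ℚᵘP.≃-trans (ℚᵘP.*-cong (unit-fraction k) (ones-sum (suc k)))
  (ℚᵘ.*≡* (trans (solve 1 (λ x → (con (+ 1) :* (con (+ 1) :+ x)) :* con (+ 1)
                                 := con (+ 1) :+ x) refl (+ k))
                  (trans (cong +_ (sym (*-identityʳ (suc k)))) (sym (ℤP.*-identityˡ _)))))))
  where open ℤSolver

half-weights : ∀ k → (+ 1 / suc (k +ℕ suc k)) + (+ 1 / suc (k +ℕ suc k)) ≡ + 1 / suc k
half-weights k = ℚP.toℚᵘ-injective
  (ℚᵘP.≃-trans (ℚP.toℚᵘ-homo-+ (+ 1 / suc (k +ℕ suc k)) (+ 1 / suc (k +ℕ suc k)))
  (ℚᵘP.≃-trans (ℚᵘP.+-cong (unit-fraction (k +ℕ suc k)) (unit-fraction (k +ℕ suc k)))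
  (ℚᵘP.≃-trans (ℚᵘ.*≡* (solve 1 (λ x → (con (+ 1) :* D x :+ con (+ 1) :* D x) :* (con (+ 1) :+ x)
                                      := con (+ 1) :* (D x :* D x)) refl (+ k)))
  (ℚᵘP.≃-sym (unit-fraction k)))))
  where open ℤSolver
        D = λ x → (con (+ 1) :+ x) :+ (con (+ 1) :+ x)

average-bound : ∀ L L′ k → L ≡ suc L′ → L ≡ suc k +ℕ suc k →
                (A B : ℚ) (f g : ℕ → ℚ) →
                (∀ m → m < L → f m ≤ℚ A + (g m + g m)) → sumTo L g ≤ℚ B →
                (+ 1 / suc L′) * sumTo L f ≤ℚ A + (+ 1 / suc k) * B
average-bound _ _ k refl refl A B f g f≤ Σg≤B = begin
    a * sumTo L f
  ≤⟨ ℚP.*-monoˡ-≤-nonNeg a {{ℚP.normalize-nonNeg 1 L}} (sum-mono L f≤) ⟩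
    a * sumTo L (λ m → A + (g m + g m))
  ≡⟨ cong (a *_) (trans (sum-+ L (λ _ → A) (λ m → g m + g m))
                        (cong₂ _+_ (sum-const L A) (sum-+ L g g))) ⟩
    a * (count * A + (Σg + Σg))
  ≡⟨ solve 4 (λ a c A S → a :* (c :* A :+ (S :+ S)) := (a :* c) :* A :+ (a :+ a) :* S)
             refl a count A Σg ⟩
    (a * count) * A + (a + a) * Σg
  ≡⟨ cong₂ (λ x y → x * A + y * Σg) (mean-weight (k +ℕ suc k)) (half-weights k) ⟩
    1ℚ * A + b * Σg
  ≤⟨ ℚP.+-mono-≤ (ℚP.≤-reflexive (ℚP.*-identityˡ A))
                 (ℚP.*-monoˡ-≤-nonNeg b {{ℚP.normalize-nonNeg 1 (suc k)}} Σg≤B) ⟩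
    A + b * B ∎
  where
    open ℚP.≤-Reasoning
    open +-*-Solver
    L = suc (k +ℕ suc k)
    a = + 1 / L
    b = + 1 / suc k
    count = sumTo L (λ _ → 1ℚ)
    Σg = sumTo L g

-- These are exactly the expressions used by rotSlot and travelA.

shift : ℕ → ℕ → ℕ → ℕ
shift L m s = if (s +ℕ m) <ᵇ L then s +ℕ m else (s +ℕ m) ∸ L

next : ℕ → ℕ → ℕ
next L x = if suc x ≡ᵇ L then 0 else suc x

shift-below : ∀ {L} m s → s +ℕ m < L → shift L m s ≡ s +ℕ m
shift-below {L} m s h rewrite reflects-true (<ᵇ-reflects-< (s +ℕ m) L) h = refl

shift-above : ∀ {L} m s → L ≤ s +ℕ m → shift L m s ≡ (s +ℕ m) ∸ L
shift-above {L} m s h rewrite reflects-false (<ᵇ-reflects-< (s +ℕ m) L) (≤⇒≯ h) = refl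

next-below : ∀ {L x} → suc x < L → next L x ≡ suc x
next-below {L} {x} h rewrite reflects-false (≡ᵇ-reflects-≡ (suc x) L) (<⇒≢ h) = refl

next-wrap : ∀ {L x} → suc x ≡ L → next L x ≡ 0
next-wrap {L} {x} h rewrite reflects-true (≡ᵇ-reflects-≡ (suc x) L) h = refl

shift-zero : ∀ {L m} → m < L → shift L m 0 ≡ m
shift-zero {m = m} = shift-below m 0

shift-full : ∀ L m → shift L m L ≡ m
shift-full L m = trans (shift-above m L (m≤m+n L m)) (m+n∸m≡n L m)

wrapped-succ< : ∀ {L m s} → s < L → m < L → L ≤ s +ℕ m → suc ((s +ℕ m) ∸ L) < L
wrapped-succ< {L} {m} {s} s<L m<L L≤s+m =
  subst (_< L) (+-∸-assoc 1 L≤s+m)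
    (m<n+o⇒m∸n<o (suc (s +ℕ m)) L {{>-nonZero (≤-<-trans z≤n m<L)}} (+-mono-≤-< s<L m<L))

shift-range : ∀ {L m s} → s < L → m < L → shift L m s < L
shift-range {L} {m} {s} s<L m<L with s +ℕ m <? L
... | yes s+m<L = subst (_< L) (sym (shift-below m s s+m<L)) s+m<L
... | no  s+m≮L = subst (_< L) (sym (shift-above m s (≮⇒≥ s+m≮L)))
                    (<-trans (n<1+n _) (wrapped-succ< s<L m<L (≮⇒≥ s+m≮L)))

next-shift : ∀ {L m s} → s < L → m < L → next L (shift L m s) ≡ shift L m (suc s)
next-shift {L} {m} {s} s<L m<L with <-cmp (suc (s +ℕ m)) L
... | tri< s+m+1<L _ _ = begin
    next L (shift L m s)  ≡⟨ cong (next L) (shift-below m s (<-trans (n<1+n _) s+m+1<L)) ⟩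
    next L (s +ℕ m)       ≡⟨ next-below s+m+1<L ⟩
    suc (s +ℕ m)          ≡⟨ sym (shift-below m (suc s) s+m+1<L) ⟩
    shift L m (suc s)     ∎
  where open ≡-Reasoning
... | tri≈ _ s+m+1≡L _ = begin
    next L (shift L m s)  ≡⟨ cong (next L) (shift-below m s (subst (s +ℕ m <_) s+m+1≡L (n<1+n _))) ⟩
    next L (s +ℕ m)       ≡⟨ next-wrap s+m+1≡L ⟩
    0                     ≡⟨ sym (trans (cong (_∸ L) s+m+1≡L) (n∸n≡0 L)) ⟩
    suc (s +ℕ m) ∸ L      ≡⟨ sym (shift-above m (suc s) (≤-reflexive (sym s+m+1≡L))) ⟩
    shift L m (suc s)     ∎
  where open ≡-Reasoning
... | tri> _ _ L<s+m+1 = begin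
    next L (shift L m s)  ≡⟨ cong (next L) (shift-above m s L≤s+m) ⟩
    next L (s +ℕ m ∸ L)   ≡⟨ next-below (wrapped-succ< s<L m<L L≤s+m) ⟩
    suc (s +ℕ m ∸ L)      ≡⟨ sym (+-∸-assoc 1 L≤s+m) ⟩
    suc (s +ℕ m) ∸ L      ≡⟨ sym (shift-above m (suc s) (<⇒≤ L<s+m+1)) ⟩
    shift L m (suc s)     ∎
  where open ≡-Reasoning
        L≤s+m = ≤-pred L<s+m+1

-- A cyclic shift only permutes the terms of a sum over all L slots:
-- the slots s < L - m go to s + m, the remaining m slots wrap to 0..m-1.
shift-sum : ∀ {L m} → m ≤ L → (c : ℕ → ℚ) → sumTo L (λ s → c (shift L m s)) ≡ sumTo L c
shift-sum {L} {m} m≤L c = begin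
    sumTo L (λ s → c (shift L m s))
  ≡⟨ cong (λ x → sumTo x (λ s → c (shift L m s))) (sym r+m≡L) ⟩
    sumTo (r +ℕ m) (λ s → c (shift L m s))
  ≡⟨ sum-split r m (λ s → c (shift L m s)) ⟩
    sumTo r (λ s → c (shift L m s)) + sumTo m (λ i → c (shift L m (r +ℕ i)))
  ≡⟨ cong₂ _+_ (sum-cong r λ s s<r → cong c (trans (shift-below m s (low s s<r)) (+-comm s m)))
               (sum-cong m λ i _ → cong c (high i)) ⟩
    sumTo r (λ s → c (m +ℕ s)) + sumTo m c
  ≡⟨ ℚP.+-comm _ (sumTo m c) ⟩
    sumTo m c + sumTo r (λ s → c (m +ℕ s))
  ≡⟨ sym (sum-split m r c) ⟩
    sumTo (m +ℕ r) c
  ≡⟨ cong (λ x → sumTo x c) (m+[n∸m]≡n m≤L) ⟩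
    sumTo L c ∎
  where
    open ≡-Reasoning
    r = L ∸ m
    r+m≡L : r +ℕ m ≡ L
    r+m≡L = m∸n+n≡m m≤L
    low : ∀ s → s < r → s +ℕ m < L
    low s s<r = subst (s +ℕ m <_) r+m≡L (+-monoˡ-< m s<r)
    high : ∀ i → shift L m (r +ℕ i) ≡ i
    high i = begin
      shift L m (r +ℕ i)   ≡⟨ shift-above m (r +ℕ i) (subst (_≤ r +ℕ i +ℕ m) r+m≡L
                                                  (+-monoˡ-≤ m (m≤m+n r i))) ⟩
      (r +ℕ i +ℕ m) ∸ L    ≡⟨ cong (_∸ L) (trans (+-assoc r i m)
                               (trans (cong (r +ℕ_) (+-comm i m))
                               (trans (sym (+-assoc r m i)) (cong (_+ℕ i) r+m≡L)))) ⟩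
      (L +ℕ i) ∸ L         ≡⟨ m+n∸m≡n L i ⟩
      i                    ∎

-- A team plays at the venues w 0, w 1, … (one per slot).
--   pathLength d k w   : length of the walk w 0 → w 1 → … → w k,
--   cycleLength d L w  : the closed walk through L slots returning to w 0
--                        (Assumption A; travelA d n t is cycleLength),
--   tourLength d h k w : the ordinary tour home h → w 0 → … → w k → h
--                        (travelOrd d n m t is tourLength on the rotated slots).

pathLength : (ℕ → ℕ → ℚ) → ℕ → (ℕ → ℕ) → ℚ
pathLength d k w = sumTo k (λ s → d (w s) (w (suc s)))

cycleLength : (ℕ → ℕ → ℚ) → ℕ → (ℕ → ℕ) → ℚ
cycleLength d L w = sumTo L (λ s → d (w s) (w (next L s)))

tourLength : (ℕ → ℕ → ℚ) → ℕ → ℕ → (ℕ → ℕ) → ℚ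
tourLength d h k w = d h (w 0) + pathLength d k w + d (w k) h

cycle-rotation : ∀ {d : ℕ → ℕ → ℚ} {L k m} (w : ℕ → ℕ) → L ≡ suc k → m < L →
                 cycleLength d L w
                   ≡ pathLength d k (λ s → w (shift L m s)) + d (w (shift L m k)) (w m)
cycle-rotation {d} {_} {k} {m} w refl m<L = begin
    sumTo L step
  ≡⟨ sym (shift-sum (<⇒≤ m<L) step) ⟩
    sumTo k (λ s → step (shift L m s)) + step (shift L m k)
  ≡⟨ cong₂ _+_ (sum-cong k λ s s<k → cong (λ x → d (w (shift L m s)) (w x))
                                          (next-shift (m<n⇒m<1+n s<k) m<L))
               (cong (λ x → d (w (shift L m k)) (w x))
                     (trans (next-shift (n<1+n k) m<L) (shift-full L m))) ⟩
    pathLength d k (λ s → w (shift L m s)) + d (w (shift L m k)) (w m) ∎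
  where
    open ≡-Reasoning
    L = suc k
    step : ℕ → ℚ
    step x = d (w x) (w (next L x))

-- The ordinary tour exceeds the closed walk w 0 → … → w k → w 0 by at most a
-- return trip between home and w 0: replace  w k → h  by  w k → w 0 → h.
tour-detour : ∀ {n d} → IsDist n d → ∀ {h k} (w : ℕ → ℕ) → h < n → w 0 < n → w k < n →
              tourLength d h k w
                ≤ℚ (pathLength d k w + d (w k) (w 0)) + (d h (w 0) + d h (w 0))
tour-detour {d = d} dist {h} {k} w h<n w₀<n wₖ<n = begin
    d h a + P + d b h
  ≤⟨ ℚP.+-monoʳ-≤ (d h a + P) (tri b a h wₖ<n w₀<n h<n) ⟩
    d h a + P + (d b a + d a h)
  ≡⟨ cong (λ x → d h a + P + (d b a + x)) (symm a h w₀<n h<n) ⟩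
    d h a + P + (d b a + d h a)
  ≡⟨ solve 3 (λ x P y → x :+ P :+ (y :+ x) := P :+ y :+ (x :+ x)) refl (d h a) P (d b a) ⟩
    (P + d b a) + (d h a + d h a) ∎
  where
    open IsDist dist
    open ℚP.≤-Reasoning
    open +-*-Solver
    a = w 0
    b = w k
    P = pathLength d k w

rotated-tour-bound : ∀ {n d} → IsDist n d → ∀ {L k h m} {w : ℕ → ℕ} → L ≡ suc k →
                     (∀ s → s < L → w s < n) → h < n → m < L →
                     tourLength d h k (λ s → w (shift L m s))
                       ≤ℚ cycleLength d L w + (d h (w m) + d h (w m))
rotated-tour-bound {n} {d} dist {L} {k} {h} {m} {w} refl w<n h<n m<L = begin
    tourLength d h k w′
  ≤⟨ tour-detour dist {k = k} w′ h<n (w′<n 0 z<s) (w′<n k (n<1+n k)) ⟩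
    (pathLength d k w′ + d (w′ k) (w′ 0)) + (d h (w′ 0) + d h (w′ 0))
  ≡⟨ cong (λ x → (pathLength d k w′ + d (w′ k) (w x)) + (d h (w x) + d h (w x)))
          (shift-zero m<L) ⟩
    (pathLength d k w′ + d (w′ k) (w m)) + (d h (w m) + d h (w m))
  ≡⟨ cong (_+ (d h (w m) + d h (w m))) (sym (cycle-rotation {d = d} w refl m<L)) ⟩
    cycleLength d L w + (d h (w m) + d h (w m)) ∎
  where
    open ℚP.≤-Reasoning
    w′ : ℕ → ℕ
    w′ s = w (shift L m s)
    w′<n : ∀ s → s < L → w′ s < n
    w′<n s s<L = w<n (shift L m s) (shift-range s<L m<L)

subMod-below : ∀ k {s t} → t ≤ s → subMod k s t ≡ s ∸ t
subMod-below k {s} {t} t≤s rewrite reflects-true (≤ᵇ-reflects-≤ t s) t≤s = refl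

subMod-above : ∀ k {s t} → s < t → subMod k s t ≡ (s +ℕ k) ∸ t
subMod-above k {s} {t} s<t rewrite reflects-false (≤ᵇ-reflects-≤ t s) (<⇒≱ s<t) = refl

subMod-range : ∀ {k s t} → s < k → t < k → subMod k s t < k
subMod-range {k} {s} {t} s<k t<k with t ≤? s
... | yes t≤s = subst (_< k) (sym (subMod-below k t≤s)) (≤-<-trans (m∸n≤m s t) s<k)
... | no  t≰s = subst (_< k) (sym (subMod-above k (≰⇒> t≰s)))
                  (m<n+o⇒m∸n<o (s +ℕ k) t {{>-nonZero (≤-<-trans z≤n s<k)}}
                     (+-monoˡ-< k (≰⇒> t≰s)))

subMod-inverse : ∀ {k s t} .{{_ : NonZero k}} → s < k → t < k → (subMod k s t +ℕ t) % k ≡ s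
subMod-inverse {k} {s} {t} s<k t<k with t ≤? s
... | yes t≤s = begin
    (subMod k s t +ℕ t) % k   ≡⟨ cong (λ x → (x +ℕ t) % k) (subMod-below k t≤s) ⟩
    (s ∸ t +ℕ t) % k          ≡⟨ cong (_% k) (m∸n+n≡m t≤s) ⟩
    s % k                     ≡⟨ m<n⇒m%n≡m s<k ⟩
    s                         ∎
  where open ≡-Reasoning
... | no t≰s = begin
    (subMod k s t +ℕ t) % k   ≡⟨ cong (λ x → (x +ℕ t) % k) (subMod-above k (≰⇒> t≰s)) ⟩
    ((s +ℕ k) ∸ t +ℕ t) % k   ≡⟨ cong (_% k) (m∸n+n≡m (≤-trans (<⇒≤ t<k) (m≤n+m k s))) ⟩
    (s +ℕ k) % k              ≡⟨ [m+n]%n≡m%n s k ⟩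
    s % k                     ≡⟨ m<n⇒m%n≡m s<k ⟩
    s                         ∎
  where open ≡-Reasoning

subMod-injective : ∀ {k s₁ s₂ t} → s₁ < k → s₂ < k → t < k →
                   subMod k s₁ t ≡ subMod k s₂ t → s₁ ≡ s₂
subMod-injective {suc _} {s₁} {s₂} {t} s₁<k s₂<k t<k e = begin
    s₁                        ≡⟨ sym (subMod-inverse s₁<k t<k) ⟩
    (subMod _ s₁ t +ℕ t) % _  ≡⟨ cong (λ x → (x +ℕ t) % _) e ⟩
    (subMod _ s₂ t +ℕ t) % _  ≡⟨ subMod-inverse s₂<k t<k ⟩
    s₂                        ∎
  where open ≡-Reasoning

-- For t ≠ n-1, K*(t,s) is (s - t) mod (n-1), except that the team whose
-- computed opponent would be t itself plays team n-1 instead.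
redirect : ℕ → ℕ → ℕ → ℕ
redirect M t x = if x ≡ᵇ t then M else x

redirect-range : ∀ {M t x} → x < M → redirect M t x < suc M
redirect-range {M} {t} {x} x<M with x ≡ᵇ t
... | true  = n<1+n M
... | false = m<n⇒m<1+n x<M

redirect-injective : ∀ {M t x₁ x₂} → x₁ < M → x₂ < M →
                     redirect M t x₁ ≡ redirect M t x₂ → x₁ ≡ x₂
redirect-injective {M} {t} {x₁} {x₂} x₁<M x₂<M e
  with x₁ ≡ᵇ t | ≡ᵇ-reflects-≡ x₁ t | x₂ ≡ᵇ t | ≡ᵇ-reflects-≡ x₂ t
... | true  | ofʸ x₁≡t | true  | ofʸ x₂≡t = trans x₁≡t (sym x₂≡t)
... | true  | _        | false | _        = ⊥-elim (<-irrefl (sym e) x₂<M)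
... | false | _        | true  | _        = ⊥-elim (<-irrefl e x₁<M)
... | false | _        | false | _        = e

Kstar-ordinary : ∀ n {t} s → t ≢ n ∸ 1 → Kstar n t s ≡ redirect (n ∸ 1) t (subMod (n ∸ 1) s t)
Kstar-ordinary n {t} s t≢n-1 rewrite reflects-false (≡ᵇ-reflects-≡ t (n ∸ 1)) t≢n-1 = refl

oppDRR-first : ∀ n t {s} → s < n ∸ 1 → oppDRR n t s ≡ Kstar n t s
oppDRR-first n t {s} s<M rewrite reflects-true (<ᵇ-reflects-< s (n ∸ 1)) s<M = refl

oppDRR-second : ∀ n t s → oppDRR n t ((n ∸ 1) +ℕ s) ≡ Kstar n t s
oppDRR-second n t s
  rewrite reflects-false (<ᵇ-reflects-< ((n ∸ 1) +ℕ s) (n ∸ 1)) (≤⇒≯ (m≤m+n (n ∸ 1) s))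
        | m+n∸m≡n (n ∸ 1) s = refl

home-distance : ∀ {n d} → IsDist n d → ∀ {t x} → t < n → homeDRR n t x ≡ true →
                d t (venueDRR n t x) ≡ 0ℚ
home-distance dist {t} t<n home rewrite home = IsDist.diag dist t t<n

venue-distance-≤ : ∀ {n d} → IsDist n d → ∀ {t x} → t < n → oppDRR n t x < n →
                   d t (venueDRR n t x) ≤ℚ d t (oppDRR n t x)
venue-distance-≤ {n} {d} dist {t} {x} t<n opp<n with homeDRR n t x
... | true  = subst (_≤ℚ d t (oppDRR n t x)) (sym (diag t t<n)) (nonneg t _ t<n opp<n)
  where open IsDist dist
... | false = ℚP.≤-refl

inWindow : ℕ → ℕ → ℕ → Bool
inWindow a b s = (a ≤ᵇ s) ∧ (s ≤ᵇ b)

in-window : ∀ {a b s} → a ≤ s → s ≤ b → inWindow a b s ≡ true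
in-window {a} {b} {s} a≤s s≤b
  rewrite reflects-true (≤ᵇ-reflects-≤ a s) a≤s | reflects-true (≤ᵇ-reflects-≤ s b) s≤b = refl

before-window : ∀ {a b s} → ¬ a ≤ s → inWindow a b s ≡ false
before-window {a} {b} {s} a≰s rewrite reflects-false (≤ᵇ-reflects-≤ a s) a≰s = refl

after-window : ∀ {a b s} → ¬ s ≤ b → inWindow a b s ≡ false
after-window {a} {b} {s} s≰b rewrite reflects-false (≤ᵇ-reflects-≤ s b) s≰b = ∧-zeroʳ (a ≤ᵇ s)

window-covers : ∀ {M a b s} → a ≤ M → a +ℕ M ≤ suc b → s < M →
                inWindow a b s ≡ true ⊎ inWindow a b (M +ℕ s) ≡ true
window-covers {M} {a} {b} {s} a≤M a+M≤1+b s<M with a ≤? s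
... | yes a≤s = inj₁ (in-window a≤s (≤-pred (<-≤-trans s<M (≤-trans (m≤n+m M a) a+M≤1+b))))
... | no  a≰s = inj₂ (in-window (≤-trans a≤M (m≤m+n M s)) (≤-pred M+s<1+b))
  where
    M+s<1+b : M +ℕ s < suc b
    M+s<1+b = <-≤-trans (+-monoʳ-< M (≰⇒> a≰s)) (subst (_≤ suc b) (+-comm a M) a+M≤1+b)

window-short : ∀ {M a b} s → suc b ≤ a +ℕ M →
               inWindow a b s ≡ false ⊎ inWindow a b (M +ℕ s) ≡ false
window-short {M} {a} {b} s short with a ≤? s
... | no  a≰s = inj₁ (before-window a≰s)
... | yes a≤s = inj₂ (after-window {a = a} λ M+s≤b →
                  <⇒≱ (≤-trans short (subst (_≤ M +ℕ s) (+-comm M a) (+-monoʳ-≤ M a≤s))) M+s≤b)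

data EvenOrOdd : ℕ → Set where
  even : ∀ q → EvenOrOdd (q +ℕ q)
  odd  : ∀ q → EvenOrOdd (suc (q +ℕ q))

even-or-odd : ∀ s → EvenOrOdd s
even-or-odd zero = even 0
even-or-odd (suc s) with even-or-odd s
... | even q = odd q
... | odd  q = subst EvenOrOdd (cong suc (+-suc q q)) (even (suc q))

even%2 : ∀ q → (q +ℕ q) % 2 ≡ 0
even%2 zero    = refl
even%2 (suc q) = trans (cong (λ x → suc x % 2) (+-suc q q)) (even%2 q)

odd%2 : ∀ q → suc (q +ℕ q) % 2 ≡ 1
odd%2 zero    = refl
odd%2 (suc q) = trans (cong (λ x → suc (suc x) % 2) (+-suc q q)) (odd%2 q)

halve-≤ : ∀ {q p} → q +ℕ q ≤ p +ℕ p → q ≤ p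
halve-≤ q+q≤p+p = ≮⇒≥ λ p<q → <⇒≱ (+-mono-< p<q p<q) q+q≤p+p

even-form : ∀ n → 0 < n → n % 2 ≡ 0 → ∃[ p ] n ≡ suc (suc (p +ℕ p))
even-form n 0<n n%2≡0 with even-or-odd n
... | even zero    = ⊥-elim (<-irrefl refl 0<n)
... | even (suc p) = p , cong suc (+-suc p p)
... | odd  q       = ⊥-elim (1≢0 (trans (sym (odd%2 q)) n%2≡0))
  where 1≢0 : 1 ≢ 0
        1≢0 ()

double-suc : ∀ j → 2 *ℕ suc (suc j) ∸ 2 ≡ suc j +ℕ suc j
double-suc j = trans (cong (j +ℕ_) (+-identityʳ (suc (suc j)))) (+-suc j (suc j))

slots-suc : ∀ j → 2 *ℕ suc (suc j) ∸ 2 ≡ suc (2 *ℕ suc (suc j) ∸ 3)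
slots-suc j = trans (double-suc j) (cong suc (sym (cong (_∸ 1) (double-suc j))))

-- The schedule K*_DRR for n = 2p + 2 teams; M = n - 1 = 2p + 1 is both the
-- last team and the number of slots per leg.
module EvenSchedule (p : ℕ) where

  n M : ℕ
  n = suc (suc (p +ℕ p))
  M = suc (p +ℕ p)

  last-even : ∀ q → Kstar n M (q +ℕ q) ≡ q
  last-even q rewrite reflects-true (≡ᵇ-reflects-≡ M M) refl | even%2 q = sym (n≡⌊n+n/2⌋ q)

  last-odd : ∀ q → Kstar n M (suc (q +ℕ q)) ≡ suc (q +ℕ p)
  last-odd q rewrite reflects-true (≡ᵇ-reflects-≡ M M) refl | odd%2 q =
    trans (cong ⌊_/2⌋ (solve 2 (λ q p → (con 1 :+ (q :+ q)) :+ (con 1 :+ (p :+ p))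
                                       := (con 1 :+ (q :+ p)) :+ (con 1 :+ (q :+ p))) refl q p))
          (sym (n≡⌊n+n/2⌋ (suc (q +ℕ p))))
    where open ℕSolver

  last-range : ∀ {s} → s < M → Kstar n M s < n
  last-range {s} s<M with even-or-odd s
  ... | even q rewrite last-even q =
    s≤s (≤-trans (halve-≤ (≤-pred s<M)) (≤-trans (m≤m+n p p) (n≤1+n (p +ℕ p))))
  ... | odd  q rewrite last-odd q =
    s≤s (s≤s (+-monoˡ-≤ p (halve-≤ (<⇒≤ (≤-pred s<M)))))

  -- Opponents met in even slots are ≤ p, those met in odd slots are > p.
  beyond-p : ∀ q′ {q} → q ≤ p → q ≢ suc (q′ +ℕ p)
  beyond-p q′ q≤p q≡ = <⇒≱ (subst (p <_) (sym q≡) (s≤s (m≤n+m p q′))) q≤p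

  last-injective : ∀ {s₁ s₂} → s₁ < M → s₂ < M → Kstar n M s₁ ≡ Kstar n M s₂ → s₁ ≡ s₂
  last-injective {s₁} {s₂} s₁<M s₂<M e with even-or-odd s₁ | even-or-odd s₂
  ... | even q₁ | even q₂ =
    cong (λ q → q +ℕ q) (trans (sym (last-even q₁)) (trans e (last-even q₂)))
  ... | odd q₁  | odd q₂  =
    cong (λ q → suc (q +ℕ q))
      (+-cancelʳ-≡ p q₁ q₂ (suc-injective (trans (sym (last-odd q₁)) (trans e (last-odd q₂)))))
  ... | even q₁ | odd q₂  =
    ⊥-elim (beyond-p q₂ (halve-≤ (≤-pred s₁<M)) (trans (sym (last-even q₁)) (trans e (last-odd q₂))))
  ... | odd q₁  | even q₂ =
    ⊥-elim (beyond-p q₁ (halve-≤ (≤-pred s₂<M)) (trans (sym (last-even q₂)) (trans (sym e) (last-odd q₁))))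

  Kstar-range : ∀ {t s} → t < n → s < M → Kstar n t s < n
  Kstar-range {t} {s} t<n s<M with m≤n⇒m<n∨m≡n (≤-pred t<n)
  ... | inj₁ t<M = subst (_< n) (sym (Kstar-ordinary n s (<⇒≢ t<M)))
                     (redirect-range (subMod-range s<M t<M))
  ... | inj₂ refl = last-range s<M

  Kstar-injective : ∀ {t s₁ s₂} → t < n → s₁ < M → s₂ < M →
                    Kstar n t s₁ ≡ Kstar n t s₂ → s₁ ≡ s₂
  Kstar-injective {t} {s₁} {s₂} t<n s₁<M s₂<M e with m≤n⇒m<n∨m≡n (≤-pred t<n)
  ... | inj₁ t<M = subMod-injective s₁<M s₂<M t<M
                     (redirect-injective (subMod-range s₁<M t<M) (subMod-range s₂<M t<M)
                        (trans (sym (Kstar-ordinary n s₁ (<⇒≢ t<M)))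
                               (trans e (Kstar-ordinary n s₂ (<⇒≢ t<M)))))
  ... | inj₂ refl = last-injective s₁<M s₂<M e

  home-last : ∀ s → homeDRR n M (M +ℕ s) ≡ true
  home-last s
    rewrite reflects-true (≡ᵇ-reflects-≡ M M) refl
          | reflects-false (≤ᵇ-reflects-≤ (M +ℕ s) (p +ℕ p))
                           (<⇒≱ (<-≤-trans (n<1+n (p +ℕ p)) (m≤m+n M s))) = refl

  home-first-half : ∀ {t s} → t ≤ p → homeDRR n t s ≡ inWindow (2 *ℕ t) (p +ℕ p +ℕ 2 *ℕ t) s
  home-first-half {t} t≤p
    rewrite reflects-false (≡ᵇ-reflects-≡ t M) (<⇒≢ (s≤s (≤-trans t≤p (m≤m+n p p))))
          | reflects-true (<ᵇ-reflects-< t (suc ⌊ p +ℕ p /2⌋))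
                          (s≤s (subst (t ≤_) (n≡⌊n+n/2⌋ p) t≤p)) = refl

  home-second-half : ∀ {t s} → p < t → t < M →
                     homeDRR n t s ≡ not (inWindow ((2 *ℕ t +ℕ 2) ∸ n) (2 *ℕ t) s)
  home-second-half {t} p<t t<M
    rewrite reflects-false (≡ᵇ-reflects-≡ t M) (<⇒≢ t<M)
          | reflects-false (<ᵇ-reflects-< t (suc ⌊ p +ℕ p /2⌋))
                           (<⇒≱ (s≤s (subst (_< t) (n≡⌊n+n/2⌋ p) p<t))) = refl

  home-in-one-leg : ∀ {t s} → t < n → s < M →
                    homeDRR n t s ≡ true ⊎ homeDRR n t (M +ℕ s) ≡ true
  home-in-one-leg {t} {s} t<n s<M with m≤n⇒m<n∨m≡n (≤-pred t<n)
  ... | inj₂ refl = inj₂ (home-last s)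
  ... | inj₁ t<M with t ≤? p
  ...   | yes t≤p
    rewrite home-first-half {s = s} t≤p | home-first-half {s = M +ℕ s} t≤p =
      window-covers (subst (_≤ M) (sym 2t≡t+t) (≤-trans (+-mono-≤ t≤p t≤p) (n≤1+n (p +ℕ p))))
                    (≤-reflexive (trans (+-suc (2 *ℕ t) (p +ℕ p))
                                        (cong suc (+-comm (2 *ℕ t) (p +ℕ p)))))
                    s<M
    where 2t≡t+t : 2 *ℕ t ≡ t +ℕ t
          2t≡t+t = cong (t +ℕ_) (+-identityʳ t)
  ...   | no t≰p with window-short {M} s short
    where
      a = (2 *ℕ t +ℕ 2) ∸ n
      short : suc (2 *ℕ t) ≤ a +ℕ M
      short = subst (suc (2 *ℕ t) ≤_) (+-comm M a)
                (≤-pred (subst (_≤ n +ℕ a) (+-comm (2 *ℕ t) 2) (m≤n+m∸n (2 *ℕ t +ℕ 2) n)))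
  ...     | inj₁ out = inj₁ (trans (home-second-half (≰⇒> t≰p) t<M) (cong not out))
  ...     | inj₂ out = inj₂ (trans (home-second-half (≰⇒> t≰p) t<M) (cong not out))

  oppDRR-range : ∀ {t s} → t < n → s < M +ℕ M → oppDRR n t s < n
  oppDRR-range {t} {s} t<n s<2M with s <? M
  ... | yes s<M = subst (_< n) (sym (oppDRR-first n t s<M)) (Kstar-range t<n s<M)
  ... | no  s≮M = subst (λ x → oppDRR n t x < n) (m+[n∸m]≡n (≮⇒≥ s≮M))
                    (subst (_< n) (sym (oppDRR-second n t (s ∸ M)))
                       (Kstar-range t<n (m<n+o⇒m∸n<o s M s<2M)))

  venue-range : ∀ {t s} → t < n → s < 2 *ℕ n ∸ 2 → venueDRR n t s < n
  venue-range {t} {s} t<n s<L with homeDRR n t s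
  ... | true  = t<n
  ... | false = oppDRR-range t<n (subst (s <_) (double-suc (p +ℕ p)) s<L)

  leg-pair-bound : ∀ {d} → IsDist n d → ∀ {t s} → t < n → s < M →
                   d t (venueDRR n t s) + d t (venueDRR n t (M +ℕ s)) ≤ℚ d t (Kstar n t s)
  leg-pair-bound {d} dist {t} {s} t<n s<M with home-in-one-leg t<n s<M
  ... | inj₁ home = begin
      d t (venueDRR n t s) + d t (venueDRR n t (M +ℕ s))
    ≡⟨ trans (cong (_+ d t (venueDRR n t (M +ℕ s))) (home-distance dist t<n home))
             (ℚP.+-identityˡ _) ⟩
      d t (venueDRR n t (M +ℕ s))
    ≤⟨ venue-distance-≤ dist t<n (subst (_< n) (sym (oppDRR-second n t s)) (Kstar-range t<n s<M)) ⟩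
      d t (oppDRR n t (M +ℕ s))
    ≡⟨ cong (d t) (oppDRR-second n t s) ⟩
      d t (Kstar n t s) ∎
    where open ℚP.≤-Reasoning
  ... | inj₂ home = begin
      d t (venueDRR n t s) + d t (venueDRR n t (M +ℕ s))
    ≡⟨ trans (cong (λ x → d t (venueDRR n t s) + x) (home-distance dist t<n home))
             (ℚP.+-identityʳ _) ⟩
      d t (venueDRR n t s)
    ≤⟨ venue-distance-≤ dist t<n (subst (_< n) (sym (oppDRR-first n t s<M)) (Kstar-range t<n s<M)) ⟩
      d t (oppDRR n t s)
    ≡⟨ cong (d t) (oppDRR-first n t s<M) ⟩
      d t (Kstar n t s) ∎
    where open ℚP.≤-Reasoning

  -- Summed over all 2n - 2 slots, the distances from home to the venues
  -- played at are at most Σ_{v' ≠ t} d t v': pair slot s with slot M + s,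
  -- then use that K*(t,·) visits every venue at most once.
  home-distance-bound : ∀ {d} → IsDist n d → ∀ {t} → t < n →
                        sumTo (2 *ℕ n ∸ 2) (λ m → d t (venueDRR n t m)) ≤ℚ distSum d n t
  home-distance-bound {d} dist {t} t<n = begin
      sumTo (2 *ℕ n ∸ 2) g
    ≡⟨ cong (λ L → sumTo L g) (double-suc (p +ℕ p)) ⟩
      sumTo (M +ℕ M) g
    ≡⟨ trans (sum-split M M g) (sym (sum-+ M g (λ s → g (M +ℕ s)))) ⟩
      sumTo M (λ s → g s + g (M +ℕ s))
    ≤⟨ sum-mono M (λ s s<M → leg-pair-bound dist t<n s<M) ⟩
      sumTo M (λ s → d t (Kstar n t s))
    ≤⟨ sum-reindex-≤ M n (Kstar n t) (d t) (λ s → Kstar-range t<n)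
                     (λ i j → Kstar-injective t<n) (λ v → nonneg t v t<n) ⟩
      sumTo n (d t)
    ≡⟨ sum-punctured n t (d t) t<n ⟩
      distSum d n t + d t t
    ≡⟨ trans (cong (λ x → distSum d n t + x) (diag t t<n)) (ℚP.+-identityʳ _) ⟩
      distSum d n t ∎
    where
      open ℚP.≤-Reasoning
      open IsDist dist
      g : ℕ → ℚ
      g m = d t (venueDRR n t m)

lemma6 : (n : ℕ) → 4 ≤ n → n % 2 ≡ 0 →
    (d : ℕ → ℕ → ℚ) → IsDist n d →
    (∀ v → v < n → distSum d n (n ∸ 1) ≤ℚ distSum d n v) →
    (t : ℕ) → t < n →
    ((+ 1 / suc (2 *ℕ n ∸ 3)) * sumTo (2 *ℕ n ∸ 2) (λ m → travelOrd d n m t))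
    ≤ℚ (travelA d n t + (+ 1 / suc (n ∸ 2)) * distSum d n t)
lemma6 n 4≤n n-even d dist _ t t<n with even-form n (≤-trans (s≤s z≤n) 4≤n) n-even
... | p , refl =
  average-bound _ _ (p +ℕ p) (slots-suc (p +ℕ p)) (double-suc (p +ℕ p))
    (travelA d n t) (distSum d n t) (λ m → travelOrd d n m t) (λ m → d t (venueDRR n t m))
    (λ m m<L → rotated-tour-bound dist (slots-suc (p +ℕ p)) (λ s → venue-range t<n) t<n m<L)
    (home-distance-bound dist t<n)
  where open EvenSchedule p using (venue-range; home-distance-bound)
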